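{- For every integer $k\geq 3$ there exists a permutation graph $G$ on $2k$ vertices with maximum degree $\Delta(G)=2k-2$ such that \textsc{Greedy} can return (for some tie-breaking) an independent set of size $2$, while a maximum independent set of $G$ has size $k$.
   Context: Graphs are finite, simple, undirected. A graph $G$ on vertex set $\{1,\ldots,n\}$ is a permutation graph if there is a permutation $\pi$ of $\{1,\ldots,n\}$ such that vertices $i<j$ are adjacent iff $j$ occurs before $i$ in $\pi$ (any graph isomorphic to such a graph is also a permutation graph). \textsc{Greedy} is the minimum-degree greedy algorithm: start with $S=\emptyset$; while the current graph is nonempty, choose any vertex of minimum degree in the current graph (ties broken arbitrarily/adversarially), add it to $S$ and delete it together with all its neighbours. -}

module Defs where

open import Data.Nat using (ℕ; _≤_; _*_; _∸_)
open import Data.Bool using (Bool; true; false)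
open import Data.Fin using (Fin; _<_)
open import Data.Fin.Subset using (Subset; _∈_; _∩_; _─_; _∪_; ∣_∣; ⁅_⁆; ⊤; Empty)
open import Data.Fin.Permutation using (Permutation′; _⟨$⟩ˡ_)
open import Data.Vec using (tabulate)
open import Data.List using (List; []; _∷_)
open import Data.Product using (Σ; _×_; _,_)
open import Data.Sum using (_⊎_)
open import Relation.Binary.PropositionalEquality using (_≡_)
open import Function.Bundles using (_⇔_)

record Graph (n : ℕ) : Set where
  field
    adj   : Fin n → Fin n → Bool
    sym   : ∀ u v → adj u v ≡ adj v u
    irref : ∀ v → adj v v ≡ false
open Graph public

Adjacent : ∀ {n} → Graph n → Fin n → Fin n → Set
Adjacent G u v = adj G u v ≡ true

N : ∀ {n} → Graph n → Fin n → Subset n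
N G v = tabulate (adj G v)

N[_] : ∀ {n} → Graph n → Fin n → Subset n
N[ G ] v = ⁅ v ⁆ ∪ N G v

degIn : ∀ {n} → Graph n → Subset n → Fin n → ℕ
degIn G alive v = ∣ alive ∩ N G v ∣

deg : ∀ {n} → Graph n → Fin n → ℕ
deg G v = degIn G ⊤ v

MaxDegreeIs : ∀ {n} → Graph n → ℕ → Set
MaxDegreeIs G d = Σ _ (λ v → deg G v ≡ d) × (∀ v → deg G v ≤ d)

-- Permutation graph on {0..n-1} given by π (π read as the sequence
-- π(0),…,π(n-1); the position of value i is π⁻¹(i)):
-- i < j are adjacent iff j occurs before i in π.
PermEdge : ∀ {n} → Permutation′ n → Fin n → Fin n → Set
PermEdge π a b =
  (a < b × (π ⟨$⟩ˡ b) < (π ⟨$⟩ˡ a)) ⊎ (b < a × (π ⟨$⟩ˡ a) < (π ⟨$⟩ˡ b))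

IsPermutationGraph : ∀ {n} → Graph n → Set
IsPermutationGraph {n} G =
  Σ (Permutation′ n) λ σ → Σ (Permutation′ n) λ π →
    ∀ u v → Adjacent G u v ⇔ PermEdge π (σ ⟨$⟩ˡ u) (σ ⟨$⟩ˡ v)

Independent : ∀ {n} → Graph n → Subset n → Set
Independent G I = ∀ u v → u ∈ I → v ∈ I → adj G u v ≡ false

IndependenceNumberIs : ∀ {n} → Graph n → ℕ → Set
IndependenceNumberIs G a =
  Σ _ (λ I → Independent G I × ∣ I ∣ ≡ a) ×
  (∀ I → Independent G I → ∣ I ∣ ≤ a)

-- GreedyRun G alive S : starting from the induced subgraph G[alive],
-- some execution of Greedy (some tie-breaking) picks the vertices of S
-- in this order and terminates.
data GreedyRun {n} (G : Graph n) : Subset n → List (Fin n) → Set where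
  done : ∀ {alive} → Empty alive → GreedyRun G alive []
  step : ∀ {alive S} (v : Fin n) →
         v ∈ alive →
         (∀ u → u ∈ alive → degIn G alive v ≤ degIn G alive u) →
         GreedyRun G (alive ─ N[ G ] v) S →
         GreedyRun G alive (v ∷ S)

GreedyCanReturn : ∀ {n} → Graph n → List (Fin n) → Set
GreedyCanReturn G S = GreedyRun G ⊤ S

-- The graph is (K₁ ⊔ K_{k−1}) ∨ E_k with E_k edgeless: a centre and a clique of k − 1 vertices,
-- with no edges between them, both joined to every vertex of an independent set O of size k.
-- Graphs built from complete and edgeless graphs by disjoint unions and joins are permutation
-- graphs: a disjoint union is realised by the direct sum of the permutations, a join by their
-- skew sum. The centre and the vertices of O have degree k and the clique vertices 2k − 2, so
-- Greedy may start with the centre; this deletes O and leaves the clique, from which Greedy takes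
-- a single vertex. O is independent, while an independent set of a join lies inside one of its
-- two sides, each of which has k vertices.

module Submission where

open import Defs hiding (sym)
open import Data.Bool using (Bool; true; false; not)
open import Data.Empty using (⊥-elim)
open import Data.Fin using (Fin; zero; suc; toℕ; opposite; _↑ˡ_; _↑ʳ_; splitAt)
open import Data.Fin.Properties
  using (_≟_; <-cmp; toℕ<n; toℕ-↑ˡ; toℕ-↑ʳ; toℕ-cast; opposite-prop; +↔⊎;
         splitAt-↑ˡ; splitAt-↑ʳ; splitAt⁻¹-↑ˡ; splitAt⁻¹-↑ʳ)
open import Data.Fin.Permutation using (Permutation′; _⟨$⟩ˡ_; reverse; cast-id) renaming (id to idₚ)
open import Data.Fin.Subset
  using (Subset; _∈_; _∉_; _∩_; _─_; _-_; ∣_∣; ⁅_⁆; ⊤; ⊥; Empty; inside; outside)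
open import Data.Fin.Subset.Properties
  using (∈⊤; ∣⊤∣≡n; ∣⊥∣≡0; ∣p∣≤n; p─⊥≡p; ∩-identityˡ; ⊆-antisym; x∈p∩q⁺; x∈p∩q⁻; x∈p∪q⁺; x∈p∪q⁻;
         x∈⁅x⁆; x∈⁅y⁆⇒x≡y; x∈p∧x≢y⇒x∈p-y; x∈p∧x∉q⇒x∈p─q; p─q⊆p; Empty-unique; nonempty?)
open import Data.List using (List; length) renaming ([] to []ᴸ; _∷_ to _∷ᴸ_)
open import Data.Nat using (ℕ; zero; suc; _+_; _*_; _∸_; _≤_; _<_; _⊔_; s≤s)
open import Data.Nat.Properties
  using (<-irrefl; <-asym; ≤-reflexive; <-≤-trans; suc-injective; m≤m+n; m≤n+m; m≤m⊔n; m≤n⊔m; ⊔-idem;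
         +-comm; +-identityʳ; *-identityˡ; +-cancelˡ-<; +-monoʳ-<; ∸-monoʳ-<; module ≤-Reasoning)
open import Data.Product using (Σ; _×_; _,_)
open import Data.Sum using (_⊎_; inj₁; inj₂)
import Data.Sum as Sum
open import Data.Sum.Algebra using (⊎-comm)
open import Data.Sum.Function.Propositional using (_⊎-↔_)
open import Data.Vec using ([]; _∷_; _++_; replicate; tabulate; here; there)
import Data.Vec as Vec
open import Data.Vec.Properties
  using (lookup∘tabulate; lookup-replicate; tabulate-cong; lookup-++ˡ; lookup-++ʳ; []=⇒lookup; lookup⇒[]=)
open import Function using (_∘_)
open import Function.Bundles using (_⇔_; mk⇔; Equivalence)
open import Function.Construct.Composition using (_↔-∘_; _⇔-∘_)
open import Function.Construct.Symmetry using (↔-sym; ⇔-sym)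
open import Relation.Binary.Definitions using (tri<; tri≈; tri>)
open import Relation.Binary.PropositionalEquality
open import Relation.Nullary using (¬_; yes; no; does; contradiction)
open import Relation.Nullary.Decidable using (dec-true; dec-false)

∣p++q∣≡∣p∣+∣q∣ : ∀ {m n} (p : Subset m) (q : Subset n) →
                 ∣ p ++ q ∣ ≡ ∣ p ∣ + ∣ q ∣
∣p++q∣≡∣p∣+∣q∣ []            q = refl
∣p++q∣≡∣p∣+∣q∣ (inside  ∷ p) q = cong suc (∣p++q∣≡∣p∣+∣q∣ p q)
∣p++q∣≡∣p∣+∣q∣ (outside ∷ p) q = ∣p++q∣≡∣p∣+∣q∣ p q

suc∣p-x∣≡∣p∣ : ∀ {n} {p : Subset n} {x} → x ∈ p → suc ∣ p - x ∣ ≡ ∣ p ∣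
suc∣p-x∣≡∣p∣ {p = inside  ∷ p} here        = cong (suc ∘ ∣_∣) (p─⊥≡p p)
suc∣p-x∣≡∣p∣ {p = inside  ∷ p} (there x∈p) = cong suc (suc∣p-x∣≡∣p∣ x∈p)
suc∣p-x∣≡∣p∣ {p = outside ∷ p} (there x∈p) = suc∣p-x∣≡∣p∣ x∈p

Empty⇒∣p∣≡0 : ∀ {n} {p : Subset n} → Empty p → ∣ p ∣ ≡ 0
Empty⇒∣p∣≡0 {n} e = trans (cong ∣_∣ (Empty-unique e)) (∣⊥∣≡0 n)

x∈p─q⇒x∉q : ∀ {n} {x : Fin n} (p q : Subset n) → x ∈ p ─ q → x ∉ q
x∈p─q⇒x∉q (_ ∷ p) (outside ∷ q) here        ()
x∈p─q⇒x∉q (_ ∷ p) (_       ∷ q) (there x∈) (there x∈q) = x∈p─q⇒x∉q p q x∈ x∈q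

↑ˡ∈++ : ∀ {m n} {p : Subset m} {a} (q : Subset n) → a ∈ p → a ↑ˡ n ∈ p ++ q
↑ˡ∈++ {p = p} {a} q a∈p =
  lookup⇒[]= (a ↑ˡ _) (p ++ q) (trans (lookup-++ˡ p q a) ([]=⇒lookup a∈p))

↑ʳ∈++ : ∀ {m n} (p : Subset m) {q : Subset n} {b} → b ∈ q → m ↑ʳ b ∈ p ++ q
↑ʳ∈++ {m} p {q} {b} b∈q =
  lookup⇒[]= (m ↑ʳ b) (p ++ q) (trans (lookup-++ʳ p q b) ([]=⇒lookup b∈q))

↑ʳ∈++⁻ : ∀ {m n} (p : Subset m) {q : Subset n} {b} → m ↑ʳ b ∈ p ++ q → b ∈ q
↑ʳ∈++⁻ {m} p {q} {b} b∈ = lookup⇒[]= b q (trans (sym (lookup-++ʳ p q b)) ([]=⇒lookup b∈))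

↑ˡ∉⊥++ : ∀ {m n} {a : Fin m} (q : Subset n) → a ↑ˡ n ∉ ⊥ ++ q
↑ˡ∉⊥++ {a = a} q a∈
  with () ← trans (sym (lookup-replicate a outside)) (trans (sym (lookup-++ˡ ⊥ q a)) ([]=⇒lookup a∈))

data Split (m n : ℕ) : Fin (m + n) → Set where
  left  : (a : Fin m) → Split m n (a ↑ˡ n)
  right : (b : Fin n) → Split m n (m ↑ʳ b)

split : ∀ m {n} (u : Fin (m + n)) → Split m n u
split m u with splitAt m u in eq
... | inj₁ a = subst (Split m _) (splitAt⁻¹-↑ˡ eq) (left a)
... | inj₂ b = subst (Split m _) (splitAt⁻¹-↑ʳ eq) (right b)

tabulate-++ : ∀ {a} {A : Set a} m {n} (f : Fin (m + n) → A) →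
              tabulate f ≡ tabulate (f ∘ (_↑ˡ n)) ++ tabulate (f ∘ (m ↑ʳ_))
tabulate-++ zero    f = refl
tabulate-++ (suc m) f = cong (f zero ∷_) (tabulate-++ m (f ∘ suc))

tabulate-const : ∀ {a} {A : Set a} n (x : A) → tabulate {n = n} (λ _ → x) ≡ replicate n x
tabulate-const zero    x = refl
tabulate-const (suc n) x = cong (x ∷_) (tabulate-const n x)

module _ {n} (G : Graph n) where

  ∈N⇔Adjacent : ∀ {u v} → u ∈ N G v ⇔ Adjacent G v u
  ∈N⇔Adjacent {u} {v} = mk⇔
    (λ u∈ → trans (sym (lookup∘tabulate (adj G v) u)) ([]=⇒lookup u∈))
    (λ v~u → lookup⇒[]= u (N G v) (trans (lookup∘tabulate (adj G v) u) v~u))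

  deg≡∣N∣ : ∀ v → deg G v ≡ ∣ N G v ∣
  deg≡∣N∣ v = cong ∣_∣ (∩-identityˡ (N G v))

  ∈N[]⇔ : ∀ {u v} → u ∈ N[ G ] v ⇔ (u ≡ v ⊎ Adjacent G v u)
  ∈N[]⇔ {u} {v} = mk⇔
    (Sum.map (x∈⁅y⁆⇒x≡y v) (Equivalence.to ∈N⇔Adjacent) ∘ x∈p∪q⁻ ⁅ v ⁆ (N G v))
    (x∈p∪q⁺ ∘ Sum.map (λ { refl → x∈⁅x⁆ v }) (Equivalence.from ∈N⇔Adjacent))

  adj≡⇒Adjacent⇔ : ∀ {u v b} → adj G u v ≡ b → Adjacent G u v ⇔ b ≡ true
  adj≡⇒Adjacent⇔ u~v≡b = mk⇔ (trans (sym u~v≡b)) (trans u~v≡b)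

  ¬Adjacent-refl : ∀ v → ¬ Adjacent G v v
  ¬Adjacent-refl v v~v with () ← trans (sym (irref G v)) v~v

  IsClique : Subset n → Set
  IsClique p = ∀ {u v} → u ∈ p → v ∈ p → u ≢ v → Adjacent G u v

  module _ {p} (clique : IsClique p) {v} (v∈p : v ∈ p) where

    clique-∩N : p ∩ N G v ≡ p - v
    clique-∩N = ⊆-antisym ⊆ ⊇
      where
      ⊆ : ∀ {u} → u ∈ p ∩ N G v → u ∈ p - v
      ⊆ u∈ with u∈p , u∈Nv ← x∈p∩q⁻ p (N G v) u∈ =
        x∈p∧x≢y⇒x∈p-y u∈p λ { refl → ¬Adjacent-refl v (Equivalence.to ∈N⇔Adjacent u∈Nv) }
      ⊇ : ∀ {u} → u ∈ p - v → u ∈ p ∩ N G v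
      ⊇ u∈ = x∈p∩q⁺ (u∈p , Equivalence.from ∈N⇔Adjacent (clique v∈p u∈p u≢v))
        where
        u∈p = p─q⊆p p ⁅ v ⁆ u∈
        u≢v = λ { refl → x∈p─q⇒x∉q p ⁅ v ⁆ u∈ (x∈⁅x⁆ v) }

    suc-degIn-clique : suc (degIn G p v) ≡ ∣ p ∣
    suc-degIn-clique = trans (cong (suc ∘ ∣_∣) clique-∩N) (suc∣p-x∣≡∣p∣ v∈p)

    clique-─N[] : Empty (p ─ N[ G ] v)
    clique-─N[] (u , u∈) = x∈p─q⇒x∉q p (N[ G ] v) u∈ (Equivalence.from ∈N[]⇔ u≡v⊎v~u)
      where
      u≡v⊎v~u : u ≡ v ⊎ Adjacent G v u
      u≡v⊎v~u with u ≟ v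
      ... | yes u≡v = inj₁ u≡v
      ... | no u≢v  = inj₂ (clique v∈p (p─q⊆p p (N[ G ] v) u∈) (u≢v ∘ sym))

  greedyRun-clique : ∀ {p} → IsClique p → ∀ {v} → v ∈ p → GreedyRun G p (v ∷ᴸ []ᴸ)
  greedyRun-clique {p} clique {v} v∈p = step v v∈p minimal (done (clique-─N[] clique v∈p))
    where
    minimal : ∀ u → u ∈ p → degIn G p v ≤ degIn G p u
    minimal u u∈p = ≤-reflexive (suc-injective
      (trans (suc-degIn-clique clique v∈p) (sym (suc-degIn-clique clique u∈p))))

emptyGraph : ∀ n → Graph n
emptyGraph n = record { adj = λ _ _ → false ; sym = λ _ _ → refl ; irref = λ _ → refl }

deg-empty : ∀ {n} (v : Fin n) → deg (emptyGraph n) v ≡ 0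
deg-empty {n} v =
  trans (deg≡∣N∣ (emptyGraph n) v) (trans (cong ∣_∣ (tabulate-const n false)) (∣⊥∣≡0 n))

completeGraph : ∀ n → Graph n
completeGraph n = record
  { adj   = λ u v → not (does (u ≟ v))
  ; sym   = λ u v → cong not (does-≟-sym u v)
  ; irref = λ v → cong not (dec-true (v ≟ v) refl)
  }
  where
  does-≟-sym : ∀ u v → does (u ≟ v) ≡ does (v ≟ u)
  does-≟-sym u v with u ≟ v
  ... | yes refl = sym (dec-true (u ≟ u) refl)
  ... | no u≢v   = sym (dec-false (v ≟ u) (u≢v ∘ sym))

Adjacent-complete⇔≢ : ∀ {n} {u v : Fin n} → Adjacent (completeGraph n) u v ⇔ u ≢ v
Adjacent-complete⇔≢ {u = u} {v} = mk⇔ to from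
  where
  to : Adjacent (completeGraph _) u v → u ≢ v
  to u~v refl = ¬Adjacent-refl (completeGraph _) u u~v
  from : u ≢ v → not (does (u ≟ v)) ≡ true
  from u≢v = cong not (dec-false (u ≟ v) u≢v)

⊤-isClique : ∀ n → IsClique (completeGraph n) ⊤
⊤-isClique n _ _ = Equivalence.from Adjacent-complete⇔≢

deg-complete : ∀ {n} (v : Fin (suc n)) → deg (completeGraph (suc n)) v ≡ n
deg-complete {n} v =
  suc-injective (trans (suc-degIn-clique (completeGraph (suc n)) (⊤-isClique (suc n)) {v} ∈⊤)
                       (∣⊤∣≡n (suc n)))

module _ {m n} (c : Bool) (G : Graph m) (H : Graph n) where

  private
    sumAdj : Fin m ⊎ Fin n → Fin m ⊎ Fin n → Bool
    sumAdj (inj₁ a) (inj₁ b) = adj G a b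
    sumAdj (inj₂ a) (inj₂ b) = adj H a b
    sumAdj (inj₁ _) (inj₂ _) = c
    sumAdj (inj₂ _) (inj₁ _) = c

    sumAdj-sym : ∀ x y → sumAdj x y ≡ sumAdj y x
    sumAdj-sym (inj₁ a) (inj₁ b) = Graph.sym G a b
    sumAdj-sym (inj₂ a) (inj₂ b) = Graph.sym H a b
    sumAdj-sym (inj₁ _) (inj₂ _) = refl
    sumAdj-sym (inj₂ _) (inj₁ _) = refl

    sumAdj-irref : ∀ x → sumAdj x x ≡ false
    sumAdj-irref (inj₁ a) = irref G a
    sumAdj-irref (inj₂ b) = irref H b

  sumGraph : Graph (m + n)
  sumGraph = record
    { adj   = λ u v → sumAdj (splitAt m u) (splitAt m v)
    ; sym   = λ u v → sumAdj-sym (splitAt m u) (splitAt m v)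
    ; irref = λ v → sumAdj-irref (splitAt m v)
    }

  adj-sum-↑ˡ↑ˡ : ∀ a b → adj sumGraph (a ↑ˡ n) (b ↑ˡ n) ≡ adj G a b
  adj-sum-↑ˡ↑ˡ a b rewrite splitAt-↑ˡ m a n | splitAt-↑ˡ m b n = refl

  adj-sum-↑ʳ↑ʳ : ∀ a b → adj sumGraph (m ↑ʳ a) (m ↑ʳ b) ≡ adj H a b
  adj-sum-↑ʳ↑ʳ a b rewrite splitAt-↑ʳ m n a | splitAt-↑ʳ m n b = refl

  adj-sum-↑ˡ↑ʳ : ∀ a b → adj sumGraph (a ↑ˡ n) (m ↑ʳ b) ≡ c
  adj-sum-↑ˡ↑ʳ a b rewrite splitAt-↑ˡ m a n | splitAt-↑ʳ m n b = refl

  adj-sum-↑ʳ↑ˡ : ∀ a b → adj sumGraph (m ↑ʳ b) (a ↑ˡ n) ≡ c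
  adj-sum-↑ʳ↑ˡ a b rewrite splitAt-↑ˡ m a n | splitAt-↑ʳ m n b = refl

  N-sum-↑ˡ : ∀ a → N sumGraph (a ↑ˡ n) ≡ N G a ++ replicate n c
  N-sum-↑ˡ a = trans (tabulate-++ m _)
    (cong₂ _++_ (tabulate-cong (adj-sum-↑ˡ↑ˡ a))
                (trans (tabulate-cong (adj-sum-↑ˡ↑ʳ a)) (tabulate-const n c)))

  N-sum-↑ʳ : ∀ b → N sumGraph (m ↑ʳ b) ≡ replicate m c ++ N H b
  N-sum-↑ʳ b = trans (tabulate-++ m _)
    (cong₂ _++_ (trans (tabulate-cong (λ a → adj-sum-↑ʳ↑ˡ a b)) (tabulate-const m c))
                (tabulate-cong (adj-sum-↑ʳ↑ʳ b)))

  deg-sum-↑ˡ : ∀ a → deg sumGraph (a ↑ˡ n) ≡ deg G a + ∣ replicate n c ∣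
  deg-sum-↑ˡ a = begin
    deg sumGraph (a ↑ˡ n)          ≡⟨ deg≡∣N∣ sumGraph (a ↑ˡ n) ⟩
    ∣ N sumGraph (a ↑ˡ n) ∣        ≡⟨ cong ∣_∣ (N-sum-↑ˡ a) ⟩
    ∣ N G a ++ replicate n c ∣     ≡⟨ ∣p++q∣≡∣p∣+∣q∣ (N G a) _ ⟩
    ∣ N G a ∣ + ∣ replicate n c ∣  ≡⟨ cong (_+ _) (deg≡∣N∣ G a) ⟨
    deg G a + ∣ replicate n c ∣    ∎
    where open ≡-Reasoning

  deg-sum-↑ʳ : ∀ b → deg sumGraph (m ↑ʳ b) ≡ ∣ replicate m c ∣ + deg H b
  deg-sum-↑ʳ b = begin
    deg sumGraph (m ↑ʳ b)          ≡⟨ deg≡∣N∣ sumGraph (m ↑ʳ b) ⟩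
    ∣ N sumGraph (m ↑ʳ b) ∣        ≡⟨ cong ∣_∣ (N-sum-↑ʳ b) ⟩
    ∣ replicate m c ++ N H b ∣     ≡⟨ ∣p++q∣≡∣p∣+∣q∣ (replicate m c) _ ⟩
    ∣ replicate m c ∣ + ∣ N H b ∣  ≡⟨ cong (_ +_) (deg≡∣N∣ H b) ⟨
    ∣ replicate m c ∣ + deg H b    ∎
    where open ≡-Reasoning

  Independent-⊥++ : ∀ {q} → Independent H q → Independent sumGraph (⊥ ++ q)
  Independent-⊥++ {q} indep u v u∈ v∈ with split m u | split m v
  ... | left a  | _       = contradiction u∈ (↑ˡ∉⊥++ q)
  ... | right _ | left b  = contradiction v∈ (↑ˡ∉⊥++ q)
  ... | right a | right b =
    trans (adj-sum-↑ʳ↑ʳ a b) (indep a b (↑ʳ∈++⁻ ⊥ u∈) (↑ʳ∈++⁻ ⊥ v∈))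

_⊔ᴳ_ _∨ᴳ_ : ∀ {m n} → Graph m → Graph n → Graph (m + n)
_⊔ᴳ_ = sumGraph false
_∨ᴳ_ = sumGraph true

Independent-∨ᴳ⇒∣I∣≤m⊔n : ∀ {m n} (G : Graph m) (H : Graph n) {I} →
                          Independent (G ∨ᴳ H) I → ∣ I ∣ ≤ m ⊔ n
Independent-∨ᴳ⇒∣I∣≤m⊔n {m} {n} G H {I} indep with Vec.splitAt m I
... | p , q , refl with nonempty? p | nonempty? q
... | yes (a , a∈p) | yes (b , b∈q)
  with () ← trans (sym (indep _ _ (↑ˡ∈++ q a∈p) (↑ʳ∈++ p b∈q))) (adj-sum-↑ˡ↑ʳ true G H a b)
... | no ∄p | _ = begin
  ∣ p ++ q ∣     ≡⟨ ∣p++q∣≡∣p∣+∣q∣ p q ⟩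
  ∣ p ∣ + ∣ q ∣  ≡⟨ cong (_+ ∣ q ∣) (Empty⇒∣p∣≡0 ∄p) ⟩
  ∣ q ∣          ≤⟨ ∣p∣≤n q ⟩
  n              ≤⟨ m≤n⊔m m n ⟩
  m ⊔ n          ∎
  where open ≤-Reasoning
... | yes _ | no ∄q = begin
  ∣ p ++ q ∣     ≡⟨ ∣p++q∣≡∣p∣+∣q∣ p q ⟩
  ∣ p ∣ + ∣ q ∣  ≡⟨ cong (∣ p ∣ +_) (Empty⇒∣p∣≡0 ∄q) ⟩
  ∣ p ∣ + 0      ≡⟨ +-identityʳ ∣ p ∣ ⟩
  ∣ p ∣          ≤⟨ ∣p∣≤n p ⟩
  m              ≤⟨ m≤m⊔n m n ⟩
  m ⊔ n          ∎
  where open ≤-Reasoning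

IsPermutationGraphOf : ∀ {n} → Graph n → Permutation′ n → Set
IsPermutationGraphOf G π = ∀ u v → Adjacent G u v ⇔ PermEdge π u v

-- PermEdge π a b unfolds to Crossing (toℕ a) (toℕ b) (toℕ (π ⟨$⟩ˡ a)) (toℕ (π ⟨$⟩ˡ b)).
Crossing : ℕ → ℕ → ℕ → ℕ → Set
Crossing x y p q = (x < y × q < p) ⊎ (y < x × p < q)

crossing-shift : ∀ s t {x y p q x′ y′ p′ q′} →
                 x′ ≡ s + x → y′ ≡ s + y → p′ ≡ t + p → q′ ≡ t + q →
                 Crossing x′ y′ p′ q′ ⇔ Crossing x y p q
crossing-shift s t refl refl refl refl = mk⇔ (Sum.map cancel cancel) (Sum.map mono mono)
  where
  cancel : ∀ {x y p q} → s + x < s + y × t + q < t + p → x < y × q < p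
  cancel (x<y , q<p) = +-cancelˡ-< s _ _ x<y , +-cancelˡ-< t _ _ q<p
  mono : ∀ {x y p q} → x < y × q < p → s + x < s + y × t + q < t + p
  mono (x<y , q<p) = +-monoʳ-< s x<y , +-monoʳ-< t q<p

crossing-< : ∀ {x y p q} → x < y → q < p → Crossing x y p q
crossing-< x<y q<p = inj₁ (x<y , q<p)

¬crossing-< : ∀ {x y p q} → x < y → p < q → ¬ Crossing x y p q
¬crossing-< x<y p<q (inj₁ (_ , q<p)) = <-asym p<q q<p
¬crossing-< x<y p<q (inj₂ (y<x , _)) = <-asym x<y y<x

↑ˡ<↑ʳ : ∀ {m n} (a : Fin m) (b : Fin n) → toℕ (a ↑ˡ n) < toℕ (m ↑ʳ b)
↑ˡ<↑ʳ {m} {n} a b =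
  subst₂ _<_ (sym (toℕ-↑ˡ a n)) (sym (toℕ-↑ʳ m b)) (<-≤-trans (toℕ<n a) (m≤m+n m (toℕ b)))

module _ {m n} {G : Graph m} {H : Graph n} {π : Permutation′ m} {ρ : Permutation′ n}
         (c : Bool) (σ : Permutation′ (m + n)) (s t : ℕ)
         (σ-↑ˡ : ∀ a → toℕ (σ ⟨$⟩ˡ (a ↑ˡ n)) ≡ s + toℕ (π ⟨$⟩ˡ a))
         (σ-↑ʳ : ∀ b → toℕ (σ ⟨$⟩ˡ (m ↑ʳ b)) ≡ t + toℕ (ρ ⟨$⟩ˡ b))
         (σ-cross : ∀ a b → PermEdge σ (a ↑ˡ n) (m ↑ʳ b) ⇔ c ≡ true)
  where

  sumGraph-isPermutationGraphOf : IsPermutationGraphOf G π → IsPermutationGraphOf H ρ →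
                                  IsPermutationGraphOf (sumGraph c G H) σ
  sumGraph-isPermutationGraphOf G≅π H≅ρ u v with split m u | split m v
  ... | left a  | left b  =
    ⇔-sym (crossing-shift 0 s (toℕ-↑ˡ a n) (toℕ-↑ˡ b n) (σ-↑ˡ a) (σ-↑ˡ b))
      ⇔-∘ (G≅π a b ⇔-∘ adj≡⇒Adjacent⇔ (sumGraph c G H) (adj-sum-↑ˡ↑ˡ c G H a b))
  ... | right a | right b =
    ⇔-sym (crossing-shift m t (toℕ-↑ʳ m a) (toℕ-↑ʳ m b) (σ-↑ʳ a) (σ-↑ʳ b))
      ⇔-∘ (H≅ρ a b ⇔-∘ adj≡⇒Adjacent⇔ (sumGraph c G H) (adj-sum-↑ʳ↑ʳ c G H a b))
  ... | left a  | right b =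
    ⇔-sym (σ-cross a b) ⇔-∘ adj≡⇒Adjacent⇔ (sumGraph c G H) (adj-sum-↑ˡ↑ʳ c G H a b)
  ... | right b | left a  =
    mk⇔ Sum.swap Sum.swap
      ⇔-∘ (⇔-sym (σ-cross a b) ⇔-∘ adj≡⇒Adjacent⇔ (sumGraph c G H) (adj-sum-↑ʳ↑ˡ c G H a b))

-- Direct and skew sum: π ⊕ₚ ρ places the positions of ρ after those of π, π ⊖ₚ ρ before them.
_⊕ₚ_ _⊖ₚ_ : ∀ {m n} → Permutation′ m → Permutation′ n → Permutation′ (m + n)
π ⊕ₚ ρ = ↔-sym +↔⊎ ↔-∘ ((π ⊎-↔ ρ) ↔-∘ +↔⊎)
_⊖ₚ_ {m} {n} π ρ =
  ↔-sym +↔⊎ ↔-∘ ((π ⊎-↔ ρ) ↔-∘ (⊎-comm _ _ ↔-∘ (+↔⊎ ↔-∘ cast-id (+-comm m n))))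

module _ {m n} (π : Permutation′ m) (ρ : Permutation′ n) where

  ⊕ₚ-↑ˡ : ∀ a → toℕ ((π ⊕ₚ ρ) ⟨$⟩ˡ (a ↑ˡ n)) ≡ toℕ (π ⟨$⟩ˡ a)
  ⊕ₚ-↑ˡ a rewrite splitAt-↑ˡ m a n = toℕ-↑ˡ (π ⟨$⟩ˡ a) n

  ⊕ₚ-↑ʳ : ∀ b → toℕ ((π ⊕ₚ ρ) ⟨$⟩ˡ (m ↑ʳ b)) ≡ m + toℕ (ρ ⟨$⟩ˡ b)
  ⊕ₚ-↑ʳ b rewrite splitAt-↑ʳ m n b = toℕ-↑ʳ m (ρ ⟨$⟩ˡ b)

  ⊖ₚ-↑ˡ : ∀ a → toℕ ((π ⊖ₚ ρ) ⟨$⟩ˡ (a ↑ˡ n)) ≡ n + toℕ (π ⟨$⟩ˡ a)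
  ⊖ₚ-↑ˡ a rewrite splitAt-↑ˡ m a n =
    trans (toℕ-cast _ (n ↑ʳ (π ⟨$⟩ˡ a))) (toℕ-↑ʳ n (π ⟨$⟩ˡ a))

  ⊖ₚ-↑ʳ : ∀ b → toℕ ((π ⊖ₚ ρ) ⟨$⟩ˡ (m ↑ʳ b)) ≡ toℕ (ρ ⟨$⟩ˡ b)
  ⊖ₚ-↑ʳ b rewrite splitAt-↑ʳ m n b =
    trans (toℕ-cast _ ((ρ ⟨$⟩ˡ b) ↑ˡ m)) (toℕ-↑ˡ (ρ ⟨$⟩ˡ b) m)

  module _ {G : Graph m} {H : Graph n}
           (G≅π : IsPermutationGraphOf G π) (H≅ρ : IsPermutationGraphOf H ρ) where

    ⊔ᴳ-isPermutationGraphOf : IsPermutationGraphOf (G ⊔ᴳ H) (π ⊕ₚ ρ)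
    ⊔ᴳ-isPermutationGraphOf =
      sumGraph-isPermutationGraphOf {G = G} {H} {π} {ρ} false (π ⊕ₚ ρ) 0 m ⊕ₚ-↑ˡ ⊕ₚ-↑ʳ cross G≅π H≅ρ
      where
      cross : ∀ a b → PermEdge (π ⊕ₚ ρ) (a ↑ˡ n) (m ↑ʳ b) ⇔ false ≡ true
      cross a b = mk⇔ (λ edge → contradiction edge (¬crossing-< (↑ˡ<↑ʳ a b) positions<)) λ ()
        where
        positions< : toℕ ((π ⊕ₚ ρ) ⟨$⟩ˡ (a ↑ˡ n)) < toℕ ((π ⊕ₚ ρ) ⟨$⟩ˡ (m ↑ʳ b))
        positions< = subst₂ _<_ (sym (⊕ₚ-↑ˡ a)) (sym (⊕ₚ-↑ʳ b))
                       (<-≤-trans (toℕ<n (π ⟨$⟩ˡ a)) (m≤m+n m _))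

    ∨ᴳ-isPermutationGraphOf : IsPermutationGraphOf (G ∨ᴳ H) (π ⊖ₚ ρ)
    ∨ᴳ-isPermutationGraphOf =
      sumGraph-isPermutationGraphOf {G = G} {H} {π} {ρ} true (π ⊖ₚ ρ) n 0 ⊖ₚ-↑ˡ ⊖ₚ-↑ʳ cross G≅π H≅ρ
      where
      cross : ∀ a b → PermEdge (π ⊖ₚ ρ) (a ↑ˡ n) (m ↑ʳ b) ⇔ true ≡ true
      cross a b = mk⇔ (λ _ → refl) λ _ → crossing-< (↑ˡ<↑ʳ a b) positions>
        where
        positions> : toℕ ((π ⊖ₚ ρ) ⟨$⟩ˡ (m ↑ʳ b)) < toℕ ((π ⊖ₚ ρ) ⟨$⟩ˡ (a ↑ˡ n))
        positions> = subst₂ _<_ (sym (⊖ₚ-↑ʳ b)) (sym (⊖ₚ-↑ˡ a))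
                       (<-≤-trans (toℕ<n (ρ ⟨$⟩ˡ b)) (m≤m+n n _))

emptyGraph-isPermutationGraphOf : ∀ n → IsPermutationGraphOf (emptyGraph n) idₚ
emptyGraph-isPermutationGraphOf n u v = mk⇔ (λ ()) λ
  { (inj₁ (u<v , v<u)) → contradiction u<v (<-asym v<u)
  ; (inj₂ (v<u , u<v)) → contradiction u<v (<-asym v<u) }

completeGraph-isPermutationGraphOf : ∀ n → IsPermutationGraphOf (completeGraph n) reverse
completeGraph-isPermutationGraphOf n u v = mk⇔ edge distinct ⇔-∘ Adjacent-complete⇔≢
  where
  opposite-< : ∀ {a b : Fin n} → toℕ a < toℕ b → toℕ (opposite b) < toℕ (opposite a)
  opposite-< {a} {b} a<b = subst₂ _<_ (sym (opposite-prop b)) (sym (opposite-prop a))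
    (∸-monoʳ-< (s≤s a<b) (toℕ<n b))
  edge : u ≢ v → PermEdge reverse u v
  edge u≢v with <-cmp u v
  ... | tri< u<v _ _ = inj₁ (u<v , opposite-< u<v)
  ... | tri≈ _ u≡v _ = contradiction u≡v u≢v
  ... | tri> _ _ v<u = inj₂ (v<u , opposite-< v<u)
  distinct : PermEdge reverse u v → u ≢ v
  distinct (inj₁ (u<v , _)) refl = <-irrefl refl u<v
  distinct (inj₂ (v<u , _)) refl = <-irrefl refl v<u

module GreedyTrap (j : ℕ) where

  k : ℕ
  k = 2 + j

  K : Graph (suc j)
  K = completeGraph (suc j)

  -- 2 * k reduces to k + 1 * k, and 2 * k ∸ 2 to j + 1 * k.
  E : Graph (1 * k)
  E = emptyGraph (1 * k)

  inner : Graph k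
  inner = completeGraph 1 ⊔ᴳ K

  trap : Graph (2 * k)
  trap = inner ∨ᴳ E

  cliqueVertex : Fin (suc j) → Fin (2 * k)
  cliqueVertex i = (1 ↑ʳ i) ↑ˡ (1 * k)

  data Role : Fin (2 * k) → Set where
    centre : Role zero
    clique : (i : Fin (suc j)) → Role (cliqueVertex i)
    outer  : (h : Fin (1 * k)) → Role (k ↑ʳ h)

  role : ∀ u → Role u
  role u with split k u
  ... | right h = outer h
  ... | left a with split 1 a
  ...   | left zero = centre
  ...   | right i   = clique i

  deg-centre : deg trap zero ≡ k
  deg-centre = begin
    deg trap zero                   ≡⟨ deg-sum-↑ˡ true inner E zero ⟩
    deg inner zero + ∣ ⊤ {1 * k} ∣
      ≡⟨ cong (_+ ∣ ⊤ {1 * k} ∣) (deg-sum-↑ˡ false (completeGraph 1) K zero) ⟩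
    ∣ ⊥ {suc j} ∣ + ∣ ⊤ {1 * k} ∣   ≡⟨ cong₂ _+_ (∣⊥∣≡0 (suc j)) (∣⊤∣≡n (1 * k)) ⟩
    1 * k                           ≡⟨ *-identityˡ k ⟩
    k                               ∎
    where open ≡-Reasoning

  deg-clique : ∀ i → deg trap (cliqueVertex i) ≡ 2 * k ∸ 2
  deg-clique i = begin
    deg trap (cliqueVertex i)           ≡⟨ deg-sum-↑ˡ true inner E (1 ↑ʳ i) ⟩
    deg inner (1 ↑ʳ i) + ∣ ⊤ {1 * k} ∣
      ≡⟨ cong₂ _+_ (deg-sum-↑ʳ false (completeGraph 1) K i) (∣⊤∣≡n (1 * k)) ⟩
    deg K i + 1 * k                     ≡⟨ cong (_+ 1 * k) (deg-complete i) ⟩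
    j + 1 * k                           ∎
    where open ≡-Reasoning

  deg-outer : ∀ h → deg trap (k ↑ʳ h) ≡ k
  deg-outer h =
    trans (deg-sum-↑ʳ true inner E h) (trans (cong₂ _+_ (∣⊤∣≡n k) (deg-empty h)) (+-identityʳ k))

  k≤2k∸2 : k ≤ 2 * k ∸ 2
  k≤2k∸2 = subst (k ≤_) (cong (j +_) (sym (*-identityˡ k))) (m≤n+m k j)

  k≤deg : ∀ u → k ≤ deg trap u
  k≤deg u with role u
  ... | centre   = ≤-reflexive (sym deg-centre)
  ... | clique i = subst (k ≤_) (sym (deg-clique i)) k≤2k∸2
  ... | outer h  = ≤-reflexive (sym (deg-outer h))

  deg≤2k∸2 : ∀ u → deg trap u ≤ 2 * k ∸ 2
  deg≤2k∸2 u with role u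
  ... | centre   = subst (_≤ 2 * k ∸ 2) (sym deg-centre) k≤2k∸2
  ... | clique i = ≤-reflexive (deg-clique i)
  ... | outer h  = subst (_≤ 2 * k ∸ 2) (sym (deg-outer h)) k≤2k∸2

  survivors : Subset (2 * k)
  survivors = ⊤ ─ N[ trap ] zero

  N[centre]∌survivor : ∀ {u} → u ≡ zero ⊎ Adjacent trap zero u → u ∉ survivors
  N[centre]∌survivor u∈N[centre] u∈ =
    x∈p─q⇒x∉q ⊤ (N[ trap ] zero) u∈ (Equivalence.from (∈N[]⇔ trap) u∈N[centre])

  survivor⇒cliqueVertex : ∀ {u} → u ∈ survivors → Σ (Fin (suc j)) λ i → u ≡ cliqueVertex i
  survivor⇒cliqueVertex {u} u∈ with role u
  ... | centre   = ⊥-elim (N[centre]∌survivor (inj₁ refl) u∈)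
  ... | clique i = i , refl
  ... | outer h  = ⊥-elim (N[centre]∌survivor (inj₂ (adj-sum-↑ˡ↑ʳ true inner E zero h)) u∈)

  survivors-isClique : IsClique trap survivors
  survivors-isClique u∈ v∈ u≢v with survivor⇒cliqueVertex u∈ | survivor⇒cliqueVertex v∈
  ... | i , refl | i′ , refl =
    Equivalence.from (adj≡⇒Adjacent⇔ trap {cliqueVertex i} {cliqueVertex i′} adj≡)
      (Equivalence.from (Adjacent-complete⇔≢ {u = i}) λ { refl → u≢v refl })
    where
    adj≡ : adj trap (cliqueVertex i) (cliqueVertex i′) ≡ adj K i i′
    adj≡ = trans (adj-sum-↑ˡ↑ˡ true inner E (1 ↑ʳ i) (1 ↑ʳ i′))
                 (adj-sum-↑ʳ↑ʳ false (completeGraph 1) K i i′)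

  cliqueVertex∈survivors : cliqueVertex zero ∈ survivors
  cliqueVertex∈survivors = x∈p∧x∉q⇒x∈p─q ∈⊤ (¬centre⊎neighbour ∘ Equivalence.to (∈N[]⇔ trap))
    where
    ¬centre⊎neighbour : ¬ (cliqueVertex zero ≡ zero ⊎ Adjacent trap zero (cliqueVertex zero))
    ¬centre⊎neighbour (inj₁ ())
    ¬centre⊎neighbour (inj₂ centre~clique)
      with () ← trans (sym centre~clique) (trans (adj-sum-↑ˡ↑ˡ true inner E zero (1 ↑ʳ zero))
                                                 (adj-sum-↑ˡ↑ʳ false (completeGraph 1) K zero zero))

  greedyRun : GreedyCanReturn trap (zero ∷ᴸ cliqueVertex zero ∷ᴸ []ᴸ)
  greedyRun = step zero ∈⊤ (λ u _ → subst (_≤ deg trap u) (sym deg-centre) (k≤deg u))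
                (greedyRun-clique trap survivors-isClique cliqueVertex∈survivors)

  outerSide : Subset (2 * k)
  outerSide = ⊥ {k} ++ ⊤ {1 * k}

  outerSide-independent : Independent trap outerSide
  outerSide-independent = Independent-⊥++ true inner E λ _ _ _ _ → refl

  ∣outerSide∣ : ∣ outerSide ∣ ≡ k
  ∣outerSide∣ = begin
    ∣ ⊥ {k} ++ ⊤ {1 * k} ∣     ≡⟨ ∣p++q∣≡∣p∣+∣q∣ (⊥ {k}) (⊤ {1 * k}) ⟩
    ∣ ⊥ {k} ∣ + ∣ ⊤ {1 * k} ∣  ≡⟨ cong₂ _+_ (∣⊥∣≡0 k) (∣⊤∣≡n (1 * k)) ⟩
    1 * k                      ≡⟨ *-identityˡ k ⟩
    k                          ∎
    where open ≡-Reasoning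

  α≤k : ∀ I → Independent trap I → ∣ I ∣ ≤ k
  α≤k I indep = subst (∣ I ∣ ≤_) (trans (cong (k ⊔_) (*-identityˡ k)) (⊔-idem k))
    (Independent-∨ᴳ⇒∣I∣≤m⊔n inner E indep)

  trapPermutation : Permutation′ (2 * k)
  trapPermutation = (reverse {1} ⊕ₚ reverse {suc j}) ⊖ₚ idₚ {1 * k}

  trap-isPermutationGraphOf : IsPermutationGraphOf trap trapPermutation
  trap-isPermutationGraphOf =
    ∨ᴳ-isPermutationGraphOf (reverse {1} ⊕ₚ reverse {suc j}) (idₚ {1 * k})
      (⊔ᴳ-isPermutationGraphOf (reverse {1}) (reverse {suc j})
        (completeGraph-isPermutationGraphOf 1) (completeGraph-isPermutationGraphOf (suc j)))
      (emptyGraph-isPermutationGraphOf (1 * k))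

  greedyTrap : Σ (Graph (2 * k)) λ G →
      IsPermutationGraph G ×
      MaxDegreeIs G (2 * k ∸ 2) ×
      Σ (List (Fin (2 * k))) (λ S → GreedyCanReturn G S × length S ≡ 2) ×
      IndependenceNumberIs G k
  greedyTrap =
    trap ,
    (idₚ , trapPermutation , trap-isPermutationGraphOf) ,
    ((cliqueVertex zero , deg-clique zero) , deg≤2k∸2) ,
    (zero ∷ᴸ cliqueVertex zero ∷ᴸ []ᴸ , greedyRun , refl) ,
    ((outerSide , outerSide-independent , ∣outerSide∣) , α≤k)

lemma6 : ∀ (k : ℕ) → 3 ≤ k →
    Σ (Graph (2 * k)) λ G →
      IsPermutationGraph G ×
      MaxDegreeIs G (2 * k ∸ 2) ×
      Σ (List (Fin (2 * k))) (λ S → GreedyCanReturn G S × length S ≡ 2) ×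
      IndependenceNumberIs G k
-- The construction works for every k ≥ 2.
lemma6 (suc (suc j)) _ = GreedyTrap.greedyTrap j
lemma6 (suc zero) (s≤s ())
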